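{- Let $x=\langle d,k,m\rangle$ and $y=\langle d',k',m'\rangle$ be nonzero elements of $M_n$, and let $k''=\max(k,k'-d)$, $m''=\min(m,m'-d)$. Then $$xy\ne\mathbf{0}\iff k''\le m''\iff k'-m\le d\le m'-k.$$
   Context: Fix an integer $n\ge 2$. For integers $d,k,m$ with $1-\min(0,d)\le k\le m\le n-\max(0,d)$, let $\langle d,k,m\rangle$ denote the $n\times n$ matrix with entries $x_{ij}$ ($i,j\in\{1,\dots,n\}$) equal to $1$ if $k\le i\le m$ and $j-i=d$, and $0$ otherwise. Let $\mathbf{0}$ be the $n\times n$ zero matrix and $M_n=\{\mathbf{0}\}\cup\{\langle d,k,m\rangle: d\in\mathbb{Z},\ k,m\in\mathbb{N},\ 1-\min(0,d)\le k\le m\le n-\max(0,d)\}$, a monoid under matrix multiplication. -}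

module Defs where

open import Data.Nat as ℕ using (ℕ; suc)
open import Data.Integer using (ℤ; +_; _-_; _≤_; _⊓_; _⊔_; _≤?_)
import Data.Integer as ℤ
open import Data.Fin using (Fin; toℕ)
open import Data.List using (map; allFin)
open import Data.Nat.ListAction using (sum)
open import Data.Product using (_×_)
open import Relation.Binary.PropositionalEquality using (_≡_)
open import Relation.Nullary using (¬_; yes; no)

-- n × n matrices over ℕ, indexed by Fin n (row/column i ↦ paper index toℕ i + 1)
Mat : ℕ → Set
Mat n = Fin n → Fin n → ℕ

idx : ∀ {n} → Fin n → ℤ
idx i = + suc (toℕ i)

_⊗_ : ∀ {n} → Mat n → Mat n → Mat n
_⊗_ {n} A B i j = sum (map (λ l → A i l ℕ.* B l j) (allFin n))

𝟎 : ∀ {n} → Mat n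
𝟎 i j = 0

_≈M_ : ∀ {n} → Mat n → Mat n → Set
A ≈M B = ∀ i j → A i j ≡ B i j

⟨_,_,_⟩ : ∀ {n} → ℤ → ℕ → ℕ → Mat n
⟨ d , k , m ⟩ i j with (+ k) ≤? idx i | idx i ≤? (+ m) | (idx j - idx i) ℤ.≟ d
... | yes _ | yes _ | yes _ = 1
... | _     | _     | _     = 0

Valid : ℕ → ℤ → ℕ → ℕ → Set
Valid n d k m = ((+ 1) - ((+ 0) ⊓ d) ≤ + k) × (k ℕ.≤ m) × (+ m ≤ (+ n) - ((+ 0) ⊔ d))

-- A product term x i l * y l j is nonzero exactly when row i lies in [k, m], column
-- l = i + d lies in [k′, m′] and j = l + d′; so xy ≠ 0 iff some integer z satisfies
-- k ≤ z ≤ m and k′ ≤ z + d ≤ m′, i.e. iff k″ = max(k, k′ - d) ≤ min(m, m′ - d) = m″.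
-- Validity of x and y is what places the witness z, z + d, z + d + d′ inside the matrix.
-- The second equivalence is the statement that [k, m] meets [k′ - d, m′ - d].
module Submission where

open import Defs
open import Data.Nat using (ℕ; _≤_)
open import Data.Integer using (ℤ; +_; _-_; _⊓_; _⊔_)
import Data.Integer as ℤ
open import Data.Product using (_×_)
open import Function.Bundles using (_⇔_)
open import Relation.Nullary using (¬_)

import Data.Nat as ℕ
import Data.Nat.Properties as ℕ
open import Data.Integer using (-[1+_]; +≤+; _+_; -_)
open import Data.Integer.Properties
  using (≤-trans; +-monoˡ-≤; +-monoʳ-≤; +-identityʳ; +-comm; ⊔-lub; ⊓-glb; i⊓j≤i; i⊓j≤j; i≤i⊔j; i≤j⊔i; module ≤-Reasoning)
open import Data.Integer.Tactic.RingSolver using (solve-∀)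
open import Data.Fin using (Fin; fromℕ<)
open import Data.Fin.Properties using (toℕ-fromℕ<)
open import Data.List using (List; []; _∷_; map; allFin)
open import Data.List.Relation.Unary.Any using (here; there)
open import Data.List.Membership.Propositional using (_∈_)
open import Data.List.Membership.Propositional.Properties using (∈-allFin)
open import Data.Nat.ListAction using (sum)
open import Data.Product using (Σ; _,_; uncurry)
open import Data.Sum using ([_,_]′)
open import Data.Empty using (⊥; ⊥-elim)
open import Function using (_∘_)
open import Function.Bundles using (mk⇔)
open import Relation.Nullary using (yes; no)
open import Relation.Nullary.Decidable using (decidable-stable)
open import Relation.Binary.PropositionalEquality using (_≡_; _≢_; refl; sym; trans; cong; subst)

[i-j]+j≡i : ∀ i j → i - j + j ≡ i
[i-j]+j≡i = solve-∀

[i+j]-j≡i : ∀ i j → i + j - j ≡ i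
[i+j]-j≡i = solve-∀

i-j≡k⇒i≡j+k : ∀ i j {k} → i - j ≡ k → i ≡ j + k
i-j≡k⇒i≡j+k i j refl = i≡j+[i-j] i j
  where
  i≡j+[i-j] : ∀ i j → i ≡ j + (i - j)
  i≡j+[i-j] = solve-∀

i≡j+k⇒i-j≡k : ∀ {i} j k → i ≡ j + k → i - j ≡ k
i≡j+k⇒i-j≡k j k refl = [j+k]-j≡k j k
  where
  [j+k]-j≡k : ∀ j k → j + k - j ≡ k
  [j+k]-j≡k = solve-∀

i≤j-k⇒i+k≤j : ∀ {i j} k → i ℤ.≤ j - k → i + k ℤ.≤ j
i≤j-k⇒i+k≤j {i} {j} k h = subst (i + k ℤ.≤_) ([i-j]+j≡i j k) (+-monoˡ-≤ k h)

i+k≤j⇒i≤j-k : ∀ {i j} k → i + k ℤ.≤ j → i ℤ.≤ j - k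
i+k≤j⇒i≤j-k {i} {j} k h = subst (ℤ._≤ j - k) ([i+j]-j≡i i k) (+-monoˡ-≤ (- k) h)

i-k≤j⇒i≤j+k : ∀ {i j} k → i - k ℤ.≤ j → i ℤ.≤ j + k
i-k≤j⇒i≤j+k {i} {j} k h = subst (ℤ._≤ j + k) ([i-j]+j≡i i k) (+-monoˡ-≤ k h)

i≤j+k⇒i-k≤j : ∀ {i j} k → i ℤ.≤ j + k → i - k ℤ.≤ j
i≤j+k⇒i-k≤j {i} {j} k h = subst (i - k ℤ.≤_) ([i+j]-j≡i j k) (+-monoˡ-≤ (- k) h)

i≤j-k⇒k≤j-i : ∀ i j k → i ℤ.≤ j - k → k ℤ.≤ j - i
i≤j-k⇒k≤j-i i j k h =
  i+k≤j⇒i≤j-k i (subst (ℤ._≤ j) (+-comm i k) (i≤j-k⇒i+k≤j k h))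

i-j≤k⇒i-k≤j : ∀ i j k → i - j ℤ.≤ k → i - k ℤ.≤ j
i-j≤k⇒i-k≤j i j k h =
  i≤j+k⇒i-k≤j k (subst (i ℤ.≤_) (+-comm k j) (i-k≤j⇒i≤j+k j h))

k⊔[k′-d]≤m⊓[m′-d]⇔k′-m≤d≤m′-k : ∀ {k m k′ m′} d → k ℤ.≤ m → k′ ℤ.≤ m′ →
  (k ⊔ (k′ - d) ℤ.≤ m ⊓ (m′ - d)) ⇔ ((k′ - m ℤ.≤ d) × (d ℤ.≤ m′ - k))
k⊔[k′-d]≤m⊓[m′-d]⇔k′-m≤d≤m′-k {k} {m} {k′} {m′} d k≤m k′≤m′ = mk⇔
  (λ h → i-j≤k⇒i-k≤j k′ d m (≤-trans (i≤j⊔i k _) (≤-trans h (i⊓j≤i m _)))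
       , i≤j-k⇒k≤j-i k m′ d (≤-trans (i≤i⊔j k _) (≤-trans h (i⊓j≤j m _))))
  (λ (k′-m≤d , d≤m′-k) → ⊔-lub (⊓-glb k≤m (i≤j-k⇒k≤j-i d m′ k d≤m′-k))
                               (⊓-glb (i-j≤k⇒i-k≤j k′ m d k′-m≤d) (+-monoˡ-≤ (- d) k′≤m′)))

sum-map-≡0 : ∀ {A : Set} (f : A → ℕ) (xs : List A) → (∀ x → f x ≡ 0) → sum (map f xs) ≡ 0
sum-map-≡0 f []       f≡0 = refl
sum-map-≡0 f (x ∷ xs) f≡0 rewrite f≡0 x = sum-map-≡0 f xs f≡0

∈⇒≤sum-map : ∀ {A : Set} (f : A → ℕ) {xs : List A} {x : A} → x ∈ xs → f x ≤ sum (map f xs)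
∈⇒≤sum-map f {x ∷ xs} (here refl) = ℕ.m≤m+n (f x) _
∈⇒≤sum-map f {x ∷ xs} (there x∈xs) = ℕ.≤-trans (∈⇒≤sum-map f x∈xs) (ℕ.m≤n+m _ (f x))

⊗-≈𝟎 : ∀ {n} {A B : Mat n} → (∀ i l j → A i l ≢ 0 → B l j ≢ 0 → ⊥) → (A ⊗ B) ≈M 𝟎
⊗-≈𝟎 {n} {A} {B} disjoint i j = sum-map-≡0 _ (allFin n) term≡0
  where
  term≡0 : ∀ l → A i l ℕ.* B l j ≡ 0
  term≡0 l with A i l ℕ.≟ 0 | B l j ℕ.≟ 0
  ... | yes a≡0 | _       = cong (ℕ._* B l j) a≡0
  ... | no _    | yes b≡0 = subst (λ b → A i l ℕ.* b ≡ 0) (sym b≡0) (ℕ.*-zeroʳ (A i l))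
  ... | no a≢0  | no b≢0  = ⊥-elim (disjoint i l j a≢0 b≢0)

⊗-≉𝟎 : ∀ {n} {A B : Mat n} {i l j} → A i l ≢ 0 → B l j ≢ 0 → ¬ (A ⊗ B) ≈M 𝟎
⊗-≉𝟎 {A = A} {B} {i} {l} {j} a≢0 b≢0 AB≈𝟎 =
  [ a≢0 , b≢0 ]′ (ℕ.m*n≡0⇒m≡0∨n≡0 (A i l) (ℕ.n≤0⇒n≡0 term≤0))
  where
  term≤0 : A i l ℕ.* B l j ≤ 0
  term≤0 = subst (A i l ℕ.* B l j ≤_) (AB≈𝟎 i j) (∈⇒≤sum-map (λ l′ → A i l′ ℕ.* B l′ j) (∈-allFin l))

InRange : ℕ → ℤ → Set
InRange n z = + 1 ℤ.≤ z × z ℤ.≤ + n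

idx-onto : ∀ {n z} → InRange n z → Σ (Fin n) λ i → idx i ≡ z
idx-onto {z = + ℕ.suc t} (_ , +≤+ t<n) = fromℕ< t<n , cong (+_ ∘ ℕ.suc) (toℕ-fromℕ< t<n)
idx-onto {z = + ℕ.zero}  (+≤+ () , _)
idx-onto {z = -[1+ _ ]}  (() , _)

Valid⇒InRange : ∀ {n d k m z} → Valid n d k m → + k ℤ.≤ z → z ℤ.≤ + m →
  InRange n z × InRange n (z + d)
Valid⇒InRange {n} {d} {k} {m} {z} (1-[0⊓d]≤k , _ , m≤n-[0⊔d]) k≤z z≤m =
  subst (InRange n) (+-identityʳ z) (1≤z+ (i⊓j≤i ℤ.+0 d) , z+≤n (i≤i⊔j ℤ.+0 d))
  , (1≤z+ (i⊓j≤j ℤ.+0 d) , z+≤n (i≤j⊔i ℤ.+0 d))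
  where
  open ≤-Reasoning
  1≤z+ : ∀ {e} → ℤ.+0 ⊓ d ℤ.≤ e → + 1 ℤ.≤ z + e
  1≤z+ {e} h = begin
    + 1            ≤⟨ i-k≤j⇒i≤j+k (ℤ.+0 ⊓ d) (≤-trans 1-[0⊓d]≤k k≤z) ⟩
    z + (ℤ.+0 ⊓ d) ≤⟨ +-monoʳ-≤ z h ⟩
    z + e          ∎
  z+≤n : ∀ {e} → e ℤ.≤ ℤ.+0 ⊔ d → z + e ℤ.≤ + n
  z+≤n {e} h = begin
    z + e          ≤⟨ +-monoʳ-≤ z h ⟩
    z + (ℤ.+0 ⊔ d) ≤⟨ i≤j-k⇒i+k≤j (ℤ.+0 ⊔ d) (≤-trans z≤m m≤n-[0⊔d]) ⟩
    + n            ∎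

⟨⟩-support : ∀ {n d k m} {i j : Fin n} → ⟨ d , k , m ⟩ i j ≢ 0 →
  + k ℤ.≤ idx i × idx i ℤ.≤ + m × idx j ≡ idx i + d
⟨⟩-support {d = d} {k} {m} {i} {j} with + k ℤ.≤? idx i | idx i ℤ.≤? + m | (idx j - idx i) ℤ.≟ d
... | yes k≤i | yes i≤m | yes j-i≡d = λ _ → k≤i , i≤m , i-j≡k⇒i≡j+k (idx j) (idx i) j-i≡d
... | no _    | _       | _         = λ ≢0 → ⊥-elim (≢0 refl)
... | yes _   | no _    | _         = λ ≢0 → ⊥-elim (≢0 refl)
... | yes _   | yes _   | no _      = λ ≢0 → ⊥-elim (≢0 refl)

⟨⟩-on-band : ∀ {n d k m z} {i j : Fin n} → idx i ≡ z → idx j ≡ z + d →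
  + k ℤ.≤ z → z ℤ.≤ + m → ⟨ d , k , m ⟩ i j ≡ 1
⟨⟩-on-band {d = d} {k} {m} {i = i} {j} refl j≡i+d k≤i i≤m
  with + k ℤ.≤? idx i | idx i ℤ.≤? + m | (idx j - idx i) ℤ.≟ d
... | yes _   | yes _   | yes _     = refl
... | no k≰i  | _       | _         = ⊥-elim (k≰i k≤i)
... | yes _   | no i≰m  | _         = ⊥-elim (i≰m i≤m)
... | yes _   | yes _   | no j-i≢d  = ⊥-elim (j-i≢d (i≡j+k⇒i-j≡k (idx i) d j≡i+d))

⟨⟩⊗⟨⟩-support : ∀ {n d k m d′ k′ m′} {i l j : Fin n} →
  ⟨ d , k , m ⟩ i l ≢ 0 → ⟨ d′ , k′ , m′ ⟩ l j ≢ 0 →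
  + k ⊔ (+ k′ - d) ℤ.≤ idx i × idx i ℤ.≤ + m ⊓ (+ m′ - d)
⟨⟩⊗⟨⟩-support {d = d} {k′ = k′} {m′} x≢0 y≢0
  with ⟨⟩-support x≢0 | ⟨⟩-support y≢0
... | k≤i , i≤m , l≡i+d | k′≤l , l≤m′ , _ =
  ⊔-lub k≤i (i≤j+k⇒i-k≤j d (subst (+ k′ ℤ.≤_) l≡i+d k′≤l)) ,
  ⊓-glb i≤m (i+k≤j⇒i≤j-k d (subst (ℤ._≤ + m′) l≡i+d l≤m′))

⟨⟩⊗⟨⟩-≉𝟎 : ∀ {n d k m d′ k′ m′} → Valid n d k m → Valid n d′ k′ m′ →
  ∀ z → + k ℤ.≤ z → z ℤ.≤ + m → + k′ ℤ.≤ z + d → z + d ℤ.≤ + m′ →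
  ¬ (⟨_,_,_⟩ {n} d k m ⊗ ⟨ d′ , k′ , m′ ⟩) ≈M 𝟎
⟨⟩⊗⟨⟩-≉𝟎 {d = d} {k} {m} {d′} {k′} {m′} valid-x valid-y z k≤z z≤m k′≤z+d z+d≤m′
  with Valid⇒InRange valid-x k≤z z≤m | Valid⇒InRange valid-y k′≤z+d z+d≤m′
... | z∈ , z+d∈ | _ , z+d+d′∈
  with idx-onto z∈ | idx-onto z+d∈ | idx-onto z+d+d′∈
... | i , i≡z | l , l≡z+d | j , j≡z+d+d′ =
  ⊗-≉𝟎 {A = ⟨ d , k , m ⟩} {B = ⟨ d′ , k′ , m′ ⟩}
    (λ x≡0 → ℕ.1+n≢0 (trans (sym (⟨⟩-on-band i≡z l≡z+d k≤z z≤m)) x≡0))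
    (λ y≡0 → ℕ.1+n≢0 (trans (sym (⟨⟩-on-band l≡z+d j≡z+d+d′ k′≤z+d z+d≤m′)) y≡0))

corollary1 : (n : ℕ) → 2 ≤ n → (d : ℤ) (k m : ℕ) (d′ : ℤ) (k′ m′ : ℕ) →
    Valid n d k m → Valid n d′ k′ m′ →
    ((¬ ((⟨_,_,_⟩ {n} d k m ⊗ ⟨_,_,_⟩ {n} d′ k′ m′) ≈M 𝟎)) ⇔ ((+ k) ⊔ ((+ k′) - d) ℤ.≤ (+ m) ⊓ ((+ m′) - d)))
    × (((+ k) ⊔ ((+ k′) - d) ℤ.≤ (+ m) ⊓ ((+ m′) - d)) ⇔ (((+ k′) - (+ m) ℤ.≤ d) × (d ℤ.≤ (+ m′) - (+ k))))
corollary1 n _ d k m d′ k′ m′ valid-x@(_ , k≤m , _) valid-y@(_ , k′≤m′ , _) =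
  mk⇔ xy≉𝟎⇒k″≤m″ k″≤m″⇒xy≉𝟎 ,
  k⊔[k′-d]≤m⊓[m′-d]⇔k′-m≤d≤m′-k d (+≤+ k≤m) (+≤+ k′≤m′)
  where
  k″ m″ : ℤ
  k″ = + k ⊔ (+ k′ - d)
  m″ = + m ⊓ (+ m′ - d)

  xy≉𝟎⇒k″≤m″ : ¬ (⟨_,_,_⟩ {n} d k m ⊗ ⟨ d′ , k′ , m′ ⟩) ≈M 𝟎 → k″ ℤ.≤ m″
  xy≉𝟎⇒k″≤m″ xy≉𝟎 = decidable-stable (k″ ℤ.≤? m″) λ k″≰m″ →
    xy≉𝟎 (⊗-≈𝟎 λ _ _ _ x≢0 y≢0 → k″≰m″ (uncurry ≤-trans (⟨⟩⊗⟨⟩-support x≢0 y≢0)))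

  k″≤m″⇒xy≉𝟎 : k″ ℤ.≤ m″ → ¬ (⟨_,_,_⟩ {n} d k m ⊗ ⟨ d′ , k′ , m′ ⟩) ≈M 𝟎
  k″≤m″⇒xy≉𝟎 k″≤m″ = ⟨⟩⊗⟨⟩-≉𝟎 valid-x valid-y k″
    (i≤i⊔j (+ k) _) (≤-trans k″≤m″ (i⊓j≤i (+ m) _))
    (i-k≤j⇒i≤j+k d (i≤j⊔i (+ k) _)) (i≤j-k⇒i+k≤j d (≤-trans k″≤m″ (i⊓j≤j (+ m) _)))
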